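{- Let $q\ge1$, $k\ge1$, $p_i\ge1$ be integers and $s_i,a_{ij},\nu$ integers. Suppose $\lceil n/q\rceil$ formally satisfies $R(n)=\sum_{i=1}^k R\big(n-s_i-\sum_{j=1}^{p_i}R(n-a_{ij})\big)+\nu$. Then $\lceil n/q\rceil$ also formally satisfies $$R'(n)=\sum_{i=1}^k R'\Big(n-s_i-\sum_{j=1}^{p_i}R'(n-a_{ij})\Big)+R'\big(n-1-R'(n-1)-R'(n-2)-\cdots-R'(n-q)\big)+\nu.$$
   Context: A sequence $B$ formally satisfies a recursion if for every $n$, replacing every occurrence of the recursion symbol by $B$ (with $B(m)=\lceil m/q\rceil$ for all integers $m$) yields a true equality. -}

module Defs where

open import Data.Nat as ℕ using (ℕ; NonZero)
open import Data.Integer using (ℤ; +_; -_; _+_; _-_; _/ℕ_)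
open import Data.Fin using (Fin)
open import Relation.Binary.PropositionalEquality using (_≡_)

sumℤ : (n : ℕ) → (Fin n → ℤ) → ℤ
sumℤ ℕ.zero    f = + 0
sumℤ (ℕ.suc n) f = f Fin.zero + sumℤ n (λ i → f (Fin.suc i))
  where import Data.Fin as Fin

-- ceiling division ⌈m/q⌉ for all integers m (q ≥ 1); _/ℕ_ is floor division
ceilDiv : (q : ℕ) .{{_ : NonZero q}} → ℤ → ℤ
ceilDiv q m = - ((- m) /ℕ q)

rhs1 : (R : ℤ → ℤ) (k : ℕ) (p : Fin k → ℕ) (s : Fin k → ℤ)
       (a : (i : Fin k) → Fin (p i) → ℤ) (ν : ℤ) (n : ℤ) → ℤ
rhs1 R k p s a ν n =
  sumℤ k (λ i → R (n - s i - sumℤ (p i) (λ j → R (n - a i j)))) + ν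

rhs2 : (R : ℤ → ℤ) (q : ℕ) (k : ℕ) (p : Fin k → ℕ) (s : Fin k → ℤ)
       (a : (i : Fin k) → Fin (p i) → ℤ) (ν : ℤ) (n : ℤ) → ℤ
rhs2 R q k p s a ν n =
  sumℤ k (λ i → R (n - s i - sumℤ (p i) (λ j → R (n - a i j))))
  + R (n - + 1 - sumℤ q (λ t → R (n - + (ℕ.suc (Data.Fin.toℕ t)))))
  + ν
  where import Data.Fin

FormallySatisfies : (B : ℤ → ℤ) → ((ℤ → ℤ) → ℤ → ℤ) → Set
FormallySatisfies B F = ∀ (n : ℤ) → B n ≡ F B n

-- Adding the term  R(n - 1 - R(n-1) - ... - R(n-q))  to a recursion solved
-- by  B(n) = ⌈n/q⌉  adds nothing, because of the integer identity
--
--     Σ_{t=1}^{q} ⌈(n - t)/q⌉ = n - 1        for every n ∈ ℤ        (★)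
--
-- so the new argument is  n - 1 - (n - 1) = 0  and  ⌈0/q⌉ = 0.

module Submission where

open import Defs
open import Data.Nat as ℕ using (ℕ; NonZero; _≥_; zero; suc)
import Data.Nat.DivMod as ℕ
open import Data.Integer
  using (ℤ; +_; -[1+_]; -_; _+_; _-_; _*_; _≤_; _<_; _/ℕ_; pred; 0ℤ)
  renaming (suc to sucℤ)
open import Data.Integer.Properties
  using ( +-assoc; +-identityˡ; +-identityʳ; +-inverseʳ; +-monoʳ-≤; +-monoʳ-<
        ; ≤-antisym; ≤-<-trans; *-cancelʳ-<-nonNeg; suc-*; pred-suc; i<j⇒i≤pred[j])
open import Data.Integer.DivMod using ([n/ℕd]*d≤n; n<s[n/ℕd]*d)
open import Data.Integer.Tactic.RingSolver using (solve-∀)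
open import Data.Fin using (Fin; toℕ)
import Data.Fin as Fin
import Data.Fin.Properties as Fin
open import Relation.Binary.PropositionalEquality
open ≡-Reasoning

unit-slope⇒translation : (h : ℤ → ℤ) → (∀ x → h (sucℤ x) ≡ sucℤ (h x)) →
                         ∀ x → h x ≡ h 0ℤ + x
unit-slope⇒translation h slope = go
  where
  sucℤ-+ : ∀ a b → + 1 + (a + b) ≡ a + (+ 1 + b)
  sucℤ-+ = solve-∀

  forward : ∀ x → h x ≡ h 0ℤ + x → h (sucℤ x) ≡ h 0ℤ + sucℤ x
  forward x hx = trans (slope x) (trans (cong sucℤ hx) (sucℤ-+ (h 0ℤ) x))

  backward : ∀ x → h (sucℤ x) ≡ h 0ℤ + sucℤ x → h x ≡ h 0ℤ + x
  backward x hx+1 = sucℤ-injective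
    (trans (sym (slope x)) (trans hx+1 (sym (sucℤ-+ (h 0ℤ) x))))
    where
    sucℤ-injective : ∀ {a b} → sucℤ a ≡ sucℤ b → a ≡ b
    sucℤ-injective {a} {b} e = trans (sym (pred-suc a)) (trans (cong pred e) (pred-suc b))

  go : ∀ x → h x ≡ h 0ℤ + x
  go (+ zero)        = sym (+-identityʳ (h 0ℤ))
  go (+ suc n)       = forward (+ n) (go (+ n))
  go -[1+ zero ]     = backward -[1+ zero ] (go 0ℤ)
  go -[1+ suc n ]    = backward -[1+ suc n ] (go -[1+ n ])

unit-slope⇒affine : (h : ℤ → ℤ) → (∀ x → h (sucℤ x) ≡ sucℤ (h x)) →
                    ∀ c x → h x ≡ h c + (x - c)
unit-slope⇒affine h slope c x = begin
  h x                        ≡⟨ translation x ⟩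
  h 0ℤ + x                   ≡⟨ rearrange (h 0ℤ) c x ⟩
  (h 0ℤ + c) + (x - c)       ≡⟨ cong (_+ (x - c)) (sym (translation c)) ⟩
  h c + (x - c)              ∎
  where
  translation : ∀ x → h x ≡ h 0ℤ + x
  translation = unit-slope⇒translation h slope
  rearrange : ∀ a c x → a + x ≡ (a + c) + (x - c)
  rearrange = solve-∀

module _ (q : ℕ) .{{_ : NonZero q}} where

  floor-bound : ∀ {m m' z} → m * + q ≤ z → z < sucℤ m' * + q → m ≤ m'
  floor-bound {m} {m'} lower upper = subst (m ≤_) (pred-suc m')
    (i<j⇒i≤pred[j] (*-cancelʳ-<-nonNeg {m} {sucℤ m'} (+ q) (≤-<-trans lower upper)))

  /ℕ-unique : ∀ {m z} → m * + q ≤ z → z < sucℤ m * + q → z /ℕ q ≡ m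
  /ℕ-unique {m} {z} lower upper = ≤-antisym
    (floor-bound ([n/ℕd]*d≤n z q) upper)
    (floor-bound lower (n<s[n/ℕd]*d z q))

  /ℕ-shift : ∀ z → (+ q + z) /ℕ q ≡ sucℤ (z /ℕ q)
  /ℕ-shift z = /ℕ-unique
    (subst (_≤ + q + z) (sym (suc-* m (+ q))) (+-monoʳ-≤ (+ q) ([n/ℕd]*d≤n z q)))
    (subst (+ q + z <_) (sym (suc-* (sucℤ m) (+ q))) (+-monoʳ-< (+ q) (n<s[n/ℕd]*d z q)))
    where
    m : ℤ
    m = z /ℕ q

  ceilDiv-shift : ∀ y → ceilDiv q y ≡ sucℤ (ceilDiv q (y - + q))
  ceilDiv-shift y = begin
    - a                               ≡⟨ neg-as-suc a ⟩
    sucℤ (- sucℤ a)                   ≡⟨ cong (λ v → sucℤ (- v)) (sym (/ℕ-shift (- y))) ⟩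
    sucℤ (- ((+ q + - y) /ℕ q))       ≡⟨ cong (λ v → sucℤ (- (v /ℕ q))) (sym (neg-minus y (+ q))) ⟩
    sucℤ (- ((- (y - + q)) /ℕ q))     ∎
    where
    a : ℤ
    a = (- y) /ℕ q
    neg-as-suc : ∀ a → - a ≡ + 1 + - (+ 1 + a)
    neg-as-suc = solve-∀
    neg-minus : ∀ y c → - (y - c) ≡ c + - y
    neg-minus = solve-∀

  ceilDiv-one-minus : ∀ t → t ℕ.< q → ceilDiv q (+ 1 - + suc t) ≡ 0ℤ
  ceilDiv-one-minus t t<q = begin
    - ((- (+ 1 - + suc t)) /ℕ q)   ≡⟨ cong (λ v → - (v /ℕ q)) (neg-one-minus (+ t)) ⟩
    - (+ (t ℕ./ q))                ≡⟨ cong (λ v → - (+ v)) (ℕ.m<n⇒m/n≡0 t<q) ⟩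
    0ℤ                             ∎
    where
    neg-one-minus : ∀ t → - (+ 1 - (+ 1 + t)) ≡ t
    neg-one-minus = solve-∀

sumℤ-cong : ∀ n {f g : Fin n → ℤ} → (∀ i → f i ≡ g i) → sumℤ n f ≡ sumℤ n g
sumℤ-cong zero    f≗g = refl
sumℤ-cong (suc n) f≗g = cong₂ _+_ (f≗g Fin.zero) (sumℤ-cong n (λ i → f≗g (Fin.suc i)))

sumℤ-zeros : ∀ n (f : Fin n → ℤ) → (∀ i → f i ≡ 0ℤ) → sumℤ n f ≡ 0ℤ
sumℤ-zeros zero    f f≗0 = refl
sumℤ-zeros (suc n) f f≗0 =
  cong₂ _+_ (f≗0 Fin.zero) (sumℤ-zeros n (λ i → f (Fin.suc i)) (λ i → f≗0 (Fin.suc i)))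

sumℤ-last : ∀ n (f : Fin (suc n) → ℤ) →
            sumℤ (suc n) f ≡ sumℤ n (λ i → f (Fin.inject₁ i)) + f (Fin.fromℕ n)
sumℤ-last zero    f = trans (+-identityʳ (f Fin.zero)) (sym (+-identityˡ (f Fin.zero)))
sumℤ-last (suc n) f = trans (cong (λ v → f Fin.zero + v) (sumℤ-last n (λ i → f (Fin.suc i))))
                            (sym (+-assoc (f Fin.zero) _ _))

window : (ℤ → ℤ) → ℕ → ℤ → ℤ
window f m x = sumℤ m (λ t → f (x - + suc (toℕ t)))

window-front : ∀ f m x → window f (suc m) (sucℤ x) ≡ f x + window f m x
window-front f m x = cong₂ _+_ (cong f (back-one x))
  (sumℤ-cong m (λ t → cong f (back-two x (+ toℕ t))))
  where
  back-one : ∀ x → + 1 + x - + 1 ≡ x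
  back-one = solve-∀
  back-two : ∀ x t → + 1 + x - (+ 1 + (+ 1 + t)) ≡ x - (+ 1 + t)
  back-two = solve-∀

window-back : ∀ f m x → window f (suc m) x ≡ window f m x + f (x - + suc m)
window-back f m x = trans (sumℤ-last m (λ t → f (x - + suc (toℕ t)))) (cong₂ _+_
  (sumℤ-cong m (λ t → cong (λ v → f (x - + suc v)) (Fin.toℕ-inject₁ t)))
  (cong (λ v → f (x - + suc v)) (Fin.toℕ-fromℕ m)))

window-unit-slope : ∀ f m → (∀ y → f y ≡ sucℤ (f (y - + suc m))) →
                    ∀ x → window f (suc m) (sucℤ x) ≡ sucℤ (window f (suc m) x)
window-unit-slope f m f-shift x = begin
  window f (suc m) (sucℤ x)                 ≡⟨ window-front f m x ⟩
  f x + window f m x                        ≡⟨ cong (_+ window f m x) (f-shift x) ⟩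
  sucℤ (f (x - + suc m)) + window f m x     ≡⟨ swap (f (x - + suc m)) (window f m x) ⟩
  sucℤ (window f m x + f (x - + suc m))     ≡⟨ cong sucℤ (sym (window-back f m x)) ⟩
  sucℤ (window f (suc m) x)                 ∎
  where
  swap : ∀ a b → (+ 1 + a) + b ≡ + 1 + (b + a)
  swap = solve-∀

ceilDiv-window : ∀ m x → window (ceilDiv (suc m)) (suc m) x ≡ x - + 1
ceilDiv-window m x = begin
  W x                ≡⟨ unit-slope⇒affine W (window-unit-slope C m (ceilDiv-shift q)) (+ 1) x ⟩
  W (+ 1) + (x - + 1) ≡⟨ cong (_+ (x - + 1)) W1≡0 ⟩
  0ℤ + (x - + 1)      ≡⟨ +-identityˡ (x - + 1) ⟩
  x - + 1             ∎
  where
  q : ℕ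
  q = suc m
  C W : ℤ → ℤ
  C = ceilDiv q
  W = window C q
  W1≡0 : W (+ 1) ≡ 0ℤ
  W1≡0 = sumℤ-zeros q _ (λ t → ceilDiv-one-minus q (toℕ t) (Fin.toℕ<n t))

rhs2≡rhs1 : (R : ℤ → ℤ) (q k : ℕ) (p : Fin k → ℕ) (s : Fin k → ℤ)
            (a : (i : Fin k) → Fin (p i) → ℤ) (ν : ℤ) →
            R 0ℤ ≡ 0ℤ → (∀ n → window R q n ≡ n - + 1) → ∀ n → rhs2 R q k p s a ν n ≡ rhs1 R k p s a ν n
rhs2≡rhs1 R q k p s a ν R0≡0 R-window n = begin
  S + R (n - + 1 - window R q n) + ν    ≡⟨ cong (λ v → S + R (n - + 1 - v) + ν) (R-window n) ⟩
  S + R (n - + 1 - (n - + 1)) + ν       ≡⟨ cong (λ v → S + R v + ν) (+-inverseʳ (n - + 1)) ⟩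
  S + R 0ℤ + ν                          ≡⟨ cong (λ v → S + v + ν) R0≡0 ⟩
  S + 0ℤ + ν                            ≡⟨ cong (_+ ν) (+-identityʳ S) ⟩
  S + ν                                 ∎
  where
  S : ℤ
  S = sumℤ k (λ i → R (n - s i - sumℤ (p i) (λ j → R (n - a i j))))

theorem5 : (q : ℕ) .{{_ : NonZero q}} (k : ℕ) → k ≥ 1 →
    (p : Fin k → ℕ) → (∀ i → p i ≥ 1) →
    (s : Fin k → ℤ) (a : (i : Fin k) → Fin (p i) → ℤ) (ν : ℤ) →
    FormallySatisfies (ceilDiv q) (λ R → rhs1 R k p s a ν) →
    FormallySatisfies (ceilDiv q) (λ R → rhs2 R q k p s a ν)
-- Writing q = m + 1, ⌈·/q⌉ vanishes at 0 and satisfies (★).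
theorem5 (suc m) k _ p _ s a ν satisfies₁ n =
  trans (satisfies₁ n) (sym (rhs2≡rhs1 (ceilDiv (suc m)) (suc m) k p s a ν refl (ceilDiv-window m) n))
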